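{- For all formulas $\phi,\psi\in\mathcal{L}$, the formulas $\mathsf{S}\phi\wedge\neg\mathsf{S}\psi\rightarrow\mathsf{S}(\phi\wedge\neg\psi)$ and $\mathsf{S}\neg\mathsf{S}\phi\rightarrow\neg\mathsf{S}\phi$ are valid in all expertise frames, i.e. true at every state of every expertise model.
   Context: Let $\mathsf{Prop}$ be a countable set of propositional variables. The language $\mathcal{L}$ is given by $\phi ::= p \mid \neg\phi \mid \phi\wedge\phi \mid \mathsf{E}\phi \mid \mathsf{S}\phi \mid \mathsf{A}\phi$. An expertise frame is $(X,P)$ with $P\subseteq 2^X$ satisfying (P1) $X\in P$, (P2) $A\in P\Rightarrow X\setminus A\in P$, (P3) closure under arbitrary intersections; an expertise model adds $v:\mathsf{Prop}\to 2^X$. Satisfaction: atoms and Boolean connectives standard; $M,x\vDash\mathsf{E}\phi$ iff $\|\phi\|_M\in P$; $M,x\vDash\mathsf{S}\phi$ iff for all $A\in P$, $\|\phi\|_M\subseteq A$ implies $x\in A$; $M,x\vDash\mathsf{A}\phi$ iff $M,y\vDash\phi$ for all $y\in X$; $\|\phi\|_M=\{x\mid M,x\vDash\phi\}$. -}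

module Defs where

open import Data.Nat using (ℕ)
open import Data.Product using (Σ; _×_; _,_)
open import Data.Empty using (⊥)
open import Relation.Nullary using (¬_)
open import Level using (0ℓ)
open import Data.Unit using (⊤)

Prop : Set
Prop = ℕ

data Form : Set where
  var : Prop → Form
  ~_  : Form → Form
  _∧_ : Form → Form → Form
  E   : Form → Form
  S   : Form → Form
  A   : Form → Form

infixr 6 _∧_
infix 7 ~_
infixr 5 _⇒_

_⇒_ : Form → Form → Form
φ ⇒ ψ = ~ (φ ∧ ~ ψ)

Subset : Set → Set₁
Subset X = X → Set

_≐_ : {X : Set} → Subset X → Subset X → Set
U ≐ V = ∀ y → (U y → V y) × (V y → U y)

-- An expertise frame (X, P).  The collection P ⊆ 2^X is given as a family
-- of subsets indexed by a (small) type Ix; a subset U belongs to P iff it is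
-- extensionally equal to some member.
record ExpertiseFrame : Set₁ where
  field
    X      : Set
    Ix     : Set
    member : Ix → Subset X
    P1 : Σ Ix (λ i → member i ≐ (λ _ → ⊤))
    P2 : ∀ i → Σ Ix (λ j → member j ≐ (λ y → ¬ member i y))
    -- (P3) closure under arbitrary intersections: for any subcollection of P
    -- (given by an index type J and a map into the indices of P), its
    -- intersection belongs to P.
    P3 : (J : Set) (f : J → Ix) →
         Σ Ix (λ k → member k ≐ (λ y → ∀ j → member (f j) y))
  InP : Subset X → Set
  InP U = Σ Ix (λ i → member i ≐ U)

record ExpertiseModel : Set₁ where
  field
    frame : ExpertiseFrame
  open ExpertiseFrame frame public
  field
    val : Prop → Subset X

module _ (M : ExpertiseModel) where
  open ExpertiseModel M

  _⊨_ : X → Form → Set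
  x ⊨ var p   = val p x
  x ⊨ (~ φ)   = ¬ (x ⊨ φ)
  x ⊨ (φ ∧ ψ) = (x ⊨ φ) × (x ⊨ ψ)
  x ⊨ E φ     = InP (λ y → y ⊨ φ)
  x ⊨ S φ     = ∀ i → (∀ y → y ⊨ φ → member i y) → member i x
  x ⊨ A φ     = ∀ y → y ⊨ φ

  ‖_‖ : Form → Subset X
  ‖ φ ‖ y = y ⊨ φ

Valid : Form → Set₁
Valid φ = (M : ExpertiseModel) (x : ExpertiseModel.X M) → _⊨_ M x φ

-- S φ holds exactly (definitionally) on the closure Cl ‖φ‖, the least element of P containing ‖φ‖,
-- which exists and lies in P by (P3).  Since P is also closed under complement,
-- ¬ Cl ‖φ‖ is in P and so is its own closure: that is the second validity.  For the
-- first, Cl ‖ψ‖ ∪ Cl ‖φ ∧ ¬ψ‖ is in P and contains ‖φ‖, hence contains Cl ‖φ‖.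
module Submission where

open import Defs
open import Data.Product using (_×_; _,_; proj₁; proj₂; Σ)
open import Data.Bool using (Bool; true; false)
open import Relation.Nullary using (¬_)

module _ (F : ExpertiseFrame) where
  open ExpertiseFrame F

  _⊆_ : Subset X → Subset X → Set
  U ⊆ V = ∀ y → U y → V y

  Cl : Subset X → Subset X
  Cl U x = ∀ i → U ⊆ member i → member i x

  InP-¬ : {U : Subset X} → InP U → InP (λ y → ¬ U y)
  InP-¬ (i , i≐U) = proj₁ (P2 i) , λ y →
      (λ m u → proj₁ (¬i y) m (proj₂ (i≐U y) u))
    , (λ ¬u → proj₂ (¬i y) (λ m → ¬u (proj₁ (i≐U y) m)))
    where
    ¬i : member (proj₁ (P2 i)) ≐ (λ y → ¬ member i y)
    ¬i = proj₂ (P2 i)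

  InP-∩ : {U V : Subset X} → InP U → InP V → InP (λ y → U y × V y)
  InP-∩ (i , i≐U) (j , j≐V) = proj₁ (P3 Bool pick) , λ y →
      (λ m → proj₁ (i≐U y) (proj₁ (⋂ y) m true) , proj₁ (j≐V y) (proj₁ (⋂ y) m false))
    , (λ (u , v) → proj₂ (⋂ y) λ where
         true  → proj₂ (i≐U y) u
         false → proj₂ (j≐V y) v)
    where
    pick : Bool → Ix
    pick true  = i
    pick false = j

    ⋂ : member (proj₁ (P3 Bool pick)) ≐ (λ y → ∀ b → member (pick b) y)
    ⋂ = proj₂ (P3 Bool pick)

  InP-Cl : (U : Subset X) → InP (Cl U)
  InP-Cl U = proj₁ (P3 Above proj₁) , λ y →
      (λ m i U⊆i → proj₁ (⋂ y) m (i , U⊆i))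
    , (λ c → proj₂ (⋂ y) (λ (i , U⊆i) → c i U⊆i))
    where
    Above : Set
    Above = Σ Ix (λ i → U ⊆ member i)

    ⋂ : member (proj₁ (P3 Above proj₁)) ≐ (λ y → ∀ a → member (proj₁ a) y)
    ⋂ = proj₂ (P3 Above proj₁)

  Cl-extensive : (U : Subset X) → U ⊆ Cl U
  Cl-extensive U y u i U⊆i = U⊆i y u

  Cl-least : {U V : Subset X} → InP V → U ⊆ V → Cl U ⊆ V
  Cl-least (i , i≐V) U⊆V x c = proj₁ (i≐V x) (c i (λ y u → proj₂ (i≐V y) (U⊆V y u)))

  Cl-¬Cl⊆¬Cl : (U : Subset X) → Cl (λ y → ¬ Cl U y) ⊆ (λ y → ¬ Cl U y)
  Cl-¬Cl⊆¬Cl U = Cl-least (InP-¬ (InP-Cl U)) (λ y ¬c → ¬c)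

  Cl-∖ : (U V : Subset X) (x : X) →
         Cl U x → ¬ Cl V x → ¬ ¬ Cl (λ y → U y × ¬ V y) x
  Cl-∖ U V x cU ¬cV ¬cU∖V = Cl-least InP-W U⊆W x cU (¬cV , ¬cU∖V)
    where
    -- Cl V ∪ Cl (U ∖ V), in the De Morgan form that P is closed under.
    W : Subset X
    W y = ¬ (¬ Cl V y × ¬ Cl (λ z → U z × ¬ V z) y)

    InP-W : InP W
    InP-W = InP-¬ (InP-∩ (InP-¬ (InP-Cl V)) (InP-¬ (InP-Cl _)))

    U⊆W : U ⊆ W
    U⊆W y u (¬cV , ¬cU∖V) =
      ¬cU∖V (Cl-extensive _ y (u , λ v → ¬cV (Cl-extensive V y v)))

lemma2 : (φ ψ : Form) →
    Valid ((S φ ∧ ~ S ψ) ⇒ S (φ ∧ ~ ψ)) × Valid (S (~ S φ) ⇒ ~ S φ)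
lemma2 φ ψ =
    (λ M x ((sφ , ¬sψ) , ¬sφ∖ψ) →
       Cl-∖ (frame M) (‖_‖ M φ) (‖_‖ M ψ) x sφ ¬sψ ¬sφ∖ψ)
  , (λ M x (s¬sφ , ¬¬sφ) → ¬¬sφ (Cl-¬Cl⊆¬Cl (frame M) (‖_‖ M φ) x s¬sφ))
  where open ExpertiseModel using (frame)
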